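{- Every simply balanceable graph is balanceable.
   Context: All graphs are finite, simple and undirected. A graph $G=(V,E)$ is simply balanceable if there exists an independent set $I$ in $G$ such that $\lfloor |E|/2\rfloor \le \sum_{x\in I} d(x) \le \lceil |E|/2\rceil$, where $d(x)$ is the degree of $x$. A $2$-coloring of the edges of $K_n$ is a map $\varphi: E(K_n)\to\{R,B\}$; it contains a balanced copy of $G$ if there is a subgraph of $K_n$ isomorphic to $G$ whose edge set can be partitioned into a red part $E_1$ and a blue part $E_2$ with $||E_1|-|E_2||\le 1$. $\mathrm{bal}(n,G)$ is the smallest integer, if it exists, with $\mathrm{bal}(n,G)<\lfloor \frac12\binom n2\rfloor$ such that every $2$-coloring of $E(K_n)$ with more than $\mathrm{bal}(n,G)$ red edges and more than $\mathrm{bal}(n,G)$ blue edges contains a balanced copy of $G$. $G$ is balanceable if there is $n_0$ such that $\mathrm{bal}(n,G)$ exists for all $n\ge n_0$. -}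

module Defs where

open import Data.Nat using (ℕ; zero; suc; _+_; _≤_; _<_; _≥_)
open import Data.Nat.DivMod using (_/_)
open import Data.Nat.Combinatorics using (_C_)
open import Data.Fin using (Fin; zero; suc; _<?_)
open import Data.Bool using (Bool; true; false; if_then_else_; _∧_)
open import Data.Product using (Σ; _×_; ∃)
open import Relation.Nullary using (¬_)
open import Relation.Nullary.Decidable using (⌊_⌋)
open import Relation.Binary.PropositionalEquality using (_≡_)
open import Function.Definitions using (Injective)

sumF : {k : ℕ} → (Fin k → ℕ) → ℕ
sumF {zero}  f = 0
sumF {suc k} f = f zero + sumF (λ i → f (suc i))

countF : {k : ℕ} → (Fin k → Bool) → ℕ
countF p = sumF (λ i → if p i then 1 else 0)

countPairs : {k : ℕ} → (Fin k → Fin k → Bool) → ℕ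
countPairs p = sumF (λ i → countF (λ j → ⌊ i <? j ⌋ ∧ p i j))

record Graph (m : ℕ) : Set where
  field
    adj    : Fin m → Fin m → Bool
    sym    : ∀ i j → adj i j ≡ adj j i
    irrefl : ∀ i → adj i i ≡ false
open Graph public

numEdges : {m : ℕ} → Graph m → ℕ
numEdges G = countPairs (adj G)

degree : {m : ℕ} → Graph m → Fin m → ℕ
degree G x = countF (adj G x)

Independent : {m : ℕ} → Graph m → (Fin m → Bool) → Set
Independent G I = ∀ x y → I x ≡ true → I y ≡ true → adj G x y ≡ false

degSum : {m : ℕ} → Graph m → (Fin m → Bool) → ℕ
degSum G I = sumF (λ x → if I x then degree G x else 0)

SimplyBalanceable : {m : ℕ} → Graph m → Set
SimplyBalanceable G =
  Σ _ λ I → Independent G I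
    × (numEdges G / 2 ≤ degSum G I)
    × (degSum G I ≤ (numEdges G + 1) / 2)

data Colour : Set where
  R B : Colour

isR isB : Colour → Bool
isR R = true
isR B = false
isB R = false
isB B = true

-- a 2-colouring of E(K_n); the colour of edge {i,j} is col i j = col j i
-- (values col i i are irrelevant)
record Colouring (n : ℕ) : Set where
  field
    col    : Fin n → Fin n → Colour
    colSym : ∀ i j → col i j ≡ col j i
open Colouring public

numRed numBlue : {n : ℕ} → Colouring n → ℕ
numRed  φ = countPairs (λ i j → isR (col φ i j))
numBlue φ = countPairs (λ i j → isB (col φ i j))

-- a balanced copy of G in φ: an injective vertex map f : V(G) → V(K_n)
-- (the image subgraph is a copy of G) whose red edges E₁ and blue edges E₂
-- satisfy ||E₁| - |E₂|| ≤ 1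
BalancedCopy : {m n : ℕ} → Graph m → Colouring n → Set
BalancedCopy {m} {n} G φ =
  Σ (Fin m → Fin n) λ f → Injective _≡_ _≡_ f
    × (redE f ≤ suc (blueE f)) × (blueE f ≤ suc (redE f))
  where
    redE blueE : (Fin m → Fin n) → ℕ
    redE  f = countPairs (λ i j → adj G i j ∧ isR (col φ (f i) (f j)))
    blueE f = countPairs (λ i j → adj G i j ∧ isB (col φ (f i) (f j)))

halfPairs : ℕ → ℕ
halfPairs n = (n C 2) / 2

BalProp : {m : ℕ} → Graph m → ℕ → ℕ → Set
BalProp G n k = ∀ (φ : Colouring n) → numRed φ > k → numBlue φ > k → BalancedCopy G φ
  where open import Data.Nat using (_>_)

-- bal(n,G) exists (and equals k): k is the smallest k < ⌊½C(n,2)⌋ with BalProp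
IsBal : {m : ℕ} → Graph m → ℕ → ℕ → Set
IsBal G n k = k < halfPairs n × BalProp G n k × (∀ j → j < k → ¬ BalProp G n j)

BalExists : {m : ℕ} → Graph m → ℕ → Set
BalExists G n = Σ ℕ λ k → IsBal G n k

Balanceable : {m : ℕ} → Graph m → Set
Balanceable G = Σ ℕ λ n₀ → ∀ n → n ≥ n₀ → BalExists G n

-- For n large, a 2-colouring of K_n with at least ⌊C(n,2)/2⌋ edges of each colour contains a
-- complete split graph with m clique and m stable vertices whose clique edges have one colour c and
-- whose cross edges have the other.  Mapping an independent set I with Σ_{x∈I} d(x) ≈ |E|/2 to the
-- stable side and the remaining vertices to the clique side embeds G so that exactly the edges meeting I
-- get the other colour, so the copy is balanced.
--
-- To find the split graph, call v large in a colour if its degree in it exceeds K/N, where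
-- N = 16(m+1), K = N·H + n·m and H = bicliqueBound m N m.  If at least 2^(2N) vertices are large in
-- both colours, Ramsey gives a monochromatic N-clique of them.  Its vertices have large degree in the
-- other colour, so their degree sum exceeds K, hence at least H vertices see m clique vertices in that
-- colour, and a Kővári–Sós–Turán count finds m of them seeing a common m-subset.  Otherwise some colour
-- has at most (n + 2^(2N))/2 large vertices, and its degree sum is then too small for half of the
-- C(n,2) edges.  Finally BalProp is decidable, so the least admissible value, bal(n,G), exists.

module Submission where

open import Defs hiding (sym)

open import Data.Bool using (Bool; true; false; if_then_else_; not; _∧_; _∨_; T)
open import Data.Bool.Properties using (T?; ∧-zeroʳ)
open import Data.Empty using (⊥-elim)
open import Data.Fin using (Fin; zero; suc; _<?_; _≟_; cast)
import Data.Fin.Properties as Fin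
open import Data.List using (List; []; _∷_; length; filter; take; lookup; tabulate; allFin; map)
open import Data.List.Membership.Propositional.Properties using (∈-lookup)
open import Data.List.Properties using (length-take; length-filter; filter-accept; filter-reject)
open import Data.List.Relation.Binary.Sublist.Propositional using (_⊆_; []; _∷_; _∷ʳ_; minimum; ⊆-trans)
open import Data.List.Relation.Binary.Sublist.Propositional.Properties using (All-resp-⊆; filter-⊆; take-⊆)
open import Data.List.Relation.Unary.All using (All; []; _∷_) renaming (map to mapAll)
import Data.List.Relation.Unary.All as All
open import Data.List.Relation.Unary.All.Properties using (all-filter) renaming (filter⁺ to All-filter⁺)
open import Data.List.Relation.Unary.AllPairs using (AllPairs; []; _∷_)
import Data.List.Relation.Unary.AllPairs as AllPairs
open import Data.List.Relation.Unary.Unique.Propositional.Properties using (allFin⁺)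
open import Data.Nat using (ℕ; zero; suc; pred; _+_; _*_; _^_; _≤_; _<_; _≤ᵇ_; _≤?_; z≤n; s≤s; NonZero; >-nonZero)
open import Data.Nat.Combinatorics using (_C_; nC1≡n; nCk+nC[k+1]≡[n+1]C[k+1])
open import Data.Nat.DivMod using (_/_; _%_; m≡m%n+[m/n]*n; m%n<n)
open import Data.Nat.ListAction using (sum)
open import Data.Nat.Properties hiding (_≟_; _<?_; _≤?_)
open import Data.Nat.Tactic.RingSolver using (solve-∀)
open import Algebra.Properties.CommutativeSemigroup +-commutativeSemigroup using (interchange)
open import Data.Product using (∃; ∃₂; _×_; _,_)
open import Data.Sum using (_⊎_; inj₁; inj₂)
open import Data.Vec using (Vec; []; _∷_) renaming (lookup to lookupᵥ; tabulate to tabulateᵥ)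
open import Data.Vec.Properties using (lookup∘tabulate)
open import Function using (_∘_; case_of_)
open import Function.Definitions using (Injective)
open import Level using (0ℓ)
open import Relation.Binary.Definitions using (Symmetric; tri<; tri≈; tri>)
open import Relation.Binary.PropositionalEquality
open import Relation.Nullary using (Dec; ¬_)
open import Relation.Nullary.Decidable
  using (⌊_⌋; yes; no; dec-true; dec-false; isYes≗does; ¬?; map′; _×-dec_; _→-dec_; decidable-stable)
open import Relation.Unary using (Pred; Decidable)

ind : Bool → ℕ
ind b = if b then 1 else 0

sumF-cong : ∀ {k} {f g : Fin k → ℕ} → (∀ i → f i ≡ g i) → sumF f ≡ sumF g
sumF-cong {zero}  f≗g = refl
sumF-cong {suc k} f≗g = cong₂ _+_ (f≗g zero) (sumF-cong (λ i → f≗g (suc i)))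

sumF-mono-≤ : ∀ {k} {f g : Fin k → ℕ} → (∀ i → f i ≤ g i) → sumF f ≤ sumF g
sumF-mono-≤ {zero}  f≤g = z≤n
sumF-mono-≤ {suc k} f≤g = +-mono-≤ (f≤g zero) (sumF-mono-≤ (λ i → f≤g (suc i)))

sumF-distrib-+ : ∀ {k} (f g : Fin k → ℕ) → sumF (λ i → f i + g i) ≡ sumF f + sumF g
sumF-distrib-+ {zero}  f g = refl
sumF-distrib-+ {suc k} f g =
  trans (cong (f zero + g zero +_) (sumF-distrib-+ (λ i → f (suc i)) (λ i → g (suc i))))
        (interchange (f zero) (g zero) _ _)

sumF-const : ∀ k c → sumF {k} (λ _ → c) ≡ k * c
sumF-const zero    c = refl
sumF-const (suc k) c = cong (c +_) (sumF-const k c)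

sumF-*ˡ : ∀ {k} c (f : Fin k → ℕ) → sumF (λ i → c * f i) ≡ c * sumF f
sumF-*ˡ {zero}  c f = sym (*-zeroʳ c)
sumF-*ˡ {suc k} c f =
  trans (cong (c * f zero +_) (sumF-*ˡ c (λ i → f (suc i)))) (sym (*-distribˡ-+ c (f zero) _))

sumF-*ʳ : ∀ {k} (f : Fin k → ℕ) c → sumF (λ i → f i * c) ≡ sumF f * c
sumF-*ʳ f c = trans (sumF-cong (λ i → *-comm (f i) c)) (trans (sumF-*ˡ c f) (*-comm c (sumF f)))

sumF-comm : ∀ {a b} (f : Fin a → Fin b → ℕ) →
            sumF (λ i → sumF (λ j → f i j)) ≡ sumF (λ j → sumF (λ i → f i j))
sumF-comm {zero}  {b} f = sym (trans (sumF-const b 0) (*-zeroʳ b))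
sumF-comm {suc a} {b} f =
  trans (cong (sumF (f zero) +_) (sumF-comm (λ i → f (suc i))))
        (sym (sumF-distrib-+ (f zero) (λ j → sumF (λ i → f (suc i) j))))

countPairs-cong : ∀ {k} {p q : Fin k → Fin k → Bool} → (∀ i j → p i j ≡ q i j) →
                  countPairs p ≡ countPairs q
countPairs-cong p≗q = sumF-cong (λ i → sumF-cong (λ j → cong (λ b → ind (⌊ i <? j ⌋ ∧ b)) (p≗q i j)))

countPairs-+ : ∀ {k} (p q r : Fin k → Fin k → Bool) →
               (∀ i j → ind (p i j) + ind (q i j) ≡ ind (r i j)) →
               countPairs p + countPairs q ≡ countPairs r
countPairs-+ p q r p+q≗r =
  trans (sym (sumF-distrib-+ (λ i → countF (λ j → ⌊ i <? j ⌋ ∧ p i j)) (λ i → countF (λ j → ⌊ i <? j ⌋ ∧ q i j))))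
        (sumF-cong λ i → trans (sym (sumF-distrib-+ (λ j → ind (⌊ i <? j ⌋ ∧ p i j)) (λ j → ind (⌊ i <? j ⌋ ∧ q i j))))
                               (sumF-cong λ j → guarded ⌊ i <? j ⌋ (p i j) (q i j) (r i j) (p+q≗r i j)))
  where
  guarded : ∀ g x y z → ind x + ind y ≡ ind z → ind (g ∧ x) + ind (g ∧ y) ≡ ind (g ∧ z)
  guarded true  x y z e = e
  guarded false x y z e = refl

⌊⌋-true : ∀ {A : Set} (a? : Dec A) → A → ⌊ a? ⌋ ≡ true
⌊⌋-true a? a = trans (isYes≗does a?) (dec-true a? a)

⌊⌋-false : ∀ {A : Set} (a? : Dec A) → ¬ A → ⌊ a? ⌋ ≡ false
⌊⌋-false a? ¬a = trans (isYes≗does a?) (dec-false a? ¬a)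

ind-≢-split : ∀ {k} (i j : Fin k) b →
              ind (not ⌊ i ≟ j ⌋ ∧ b) ≡ ind (⌊ i <? j ⌋ ∧ b) + ind (⌊ j <? i ⌋ ∧ b)
ind-≢-split i j b with Fin.<-cmp i j
... | tri< i<j i≢j j≮i
  rewrite ⌊⌋-false (i ≟ j) i≢j | ⌊⌋-true (i <? j) i<j | ⌊⌋-false (j <? i) j≮i = sym (+-identityʳ _)
... | tri≈ i≮i refl _
  rewrite ⌊⌋-true (i ≟ i) refl | ⌊⌋-false (i <? i) i≮i = refl
... | tri> i≮j i≢j j<i
  rewrite ⌊⌋-false (i ≟ j) i≢j | ⌊⌋-false (i <? j) i≮j | ⌊⌋-true (j <? i) j<i = refl

sumF-countF-≢ : ∀ {k} (p : Fin k → Fin k → Bool) →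
                sumF (λ i → countF (λ j → not ⌊ i ≟ j ⌋ ∧ p i j)) ≡ countPairs p + countPairs (λ i j → p j i)
sumF-countF-≢ p = begin
    sumF (λ i → countF (λ j → not ⌊ i ≟ j ⌋ ∧ p i j))
  ≡⟨ sumF-cong (λ i → trans (sumF-cong (λ j → ind-≢-split i j (p i j)))
                            (sumF-distrib-+ (λ j → ind (⌊ i <? j ⌋ ∧ p i j)) (λ j → ind (⌊ j <? i ⌋ ∧ p i j)))) ⟩
    sumF (λ i → countF (λ j → ⌊ i <? j ⌋ ∧ p i j) + countF (λ j → ⌊ j <? i ⌋ ∧ p i j))
  ≡⟨ sumF-distrib-+ (λ i → countF (λ j → ⌊ i <? j ⌋ ∧ p i j)) (λ i → countF (λ j → ⌊ j <? i ⌋ ∧ p i j)) ⟩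
    countPairs p + sumF (λ i → countF (λ j → ⌊ j <? i ⌋ ∧ p i j))
  ≡⟨ cong (countPairs p +_) (sumF-comm (λ i j → ind (⌊ j <? i ⌋ ∧ p i j))) ⟩
    countPairs p + countPairs (λ i j → p j i)
  ∎
  where open ≡-Reasoning

≤-half : ∀ t → t ≤ t / 2 + t / 2 + 1
≤-half t = begin
    t                      ≡⟨ m≡m%n+[m/n]*n t 2 ⟩
    t % 2 + t / 2 * 2      ≤⟨ +-monoˡ-≤ (t / 2 * 2) (≤-pred (m%n<n t 2)) ⟩
    1 + t / 2 * 2          ≡⟨ lemma (t / 2) ⟩
    t / 2 + t / 2 + 1      ∎
  where
  open ≤-Reasoning
  lemma : ∀ h → 1 + h * 2 ≡ h + h + 1
  lemma = solve-∀

half-≤ : ∀ t → t / 2 + t / 2 ≤ t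
half-≤ t = begin
    t / 2 + t / 2          ≡⟨ lemma (t / 2) ⟩
    t / 2 * 2              ≤⟨ m≤n+m (t / 2 * 2) (t % 2) ⟩
    t % 2 + t / 2 * 2      ≡⟨ m≡m%n+[m/n]*n t 2 ⟨
    t                      ∎
  where
  open ≤-Reasoning
  lemma : ∀ h → h + h ≡ h * 2
  lemma = solve-∀

nC2+nC2+n≡n*n : ∀ n → n C 2 + n C 2 + n ≡ n * n
nC2+nC2+n≡n*n zero    = refl
nC2+nC2+n≡n*n (suc n) = begin
    suc n C 2 + suc n C 2 + suc n          ≡⟨ cong (λ t → t + t + suc n) [n+1]C2 ⟩
    (n + n C 2) + (n + n C 2) + suc n      ≡⟨ regroup n (n C 2) ⟩
    (n C 2 + n C 2 + n) + (n + suc n)      ≡⟨ cong (_+ (n + suc n)) (nC2+nC2+n≡n*n n) ⟩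
    n * n + (n + suc n)                    ≡⟨ square n ⟩
    suc n * suc n                          ∎
  where
  open ≡-Reasoning
  [n+1]C2 : suc n C 2 ≡ n + n C 2
  [n+1]C2 = trans (sym (nCk+nC[k+1]≡[n+1]C[k+1] n 1)) (cong (_+ n C 2) (nC1≡n n))
  regroup : ∀ n c → (n + c) + (n + c) + suc n ≡ (c + c + n) + (n + suc n)
  regroup = solve-∀
  square : ∀ n → n * n + (n + suc n) ≡ suc n * suc n
  square = solve-∀

square≤4*halfPairs : ∀ n → n * n ≤ 4 * halfPairs n + 2 + n
square≤4*halfPairs n = begin
    n * n                                           ≡⟨ nC2+nC2+n≡n*n n ⟨
    n C 2 + n C 2 + n                               ≤⟨ +-monoˡ-≤ n (+-mono-≤ (≤-half (n C 2)) (≤-half (n C 2))) ⟩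
    (h + h + 1) + (h + h + 1) + n                   ≡⟨ lemma h n ⟩
    4 * h + 2 + n                                   ∎
  where
  open ≤-Reasoning
  h = halfPairs n
  lemma : ∀ h n → (h + h + 1) + (h + h + 1) + n ≡ 4 * h + 2 + n
  lemma = solve-∀

near-half⇒balanced : ∀ a b → (a + b) / 2 ≤ b → b ≤ (a + b + 1) / 2 → a ≤ suc b × b ≤ suc a
near-half⇒balanced a b lower upper = +-cancelʳ-≤ b a (suc b) a+b≤ , +-cancelʳ-≤ b b (suc a) b+b≤
  where
  open ≤-Reasoning
  a+b≤ : a + b ≤ suc b + b
  a+b≤ = begin
    a + b                              ≤⟨ ≤-half (a + b) ⟩
    (a + b) / 2 + (a + b) / 2 + 1      ≤⟨ +-monoˡ-≤ 1 (+-mono-≤ lower lower) ⟩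
    b + b + 1                          ≡⟨ +-comm (b + b) 1 ⟩
    suc b + b                          ∎
  b+b≤ : b + b ≤ suc a + b
  b+b≤ = begin
    b + b                                   ≤⟨ +-mono-≤ upper upper ⟩
    (a + b + 1) / 2 + (a + b + 1) / 2       ≤⟨ half-≤ (a + b + 1) ⟩
    a + b + 1                               ≡⟨ +-comm (a + b) 1 ⟩
    suc a + b                               ∎

density-inequality : ∀ m n H S p → n * n ≤ 2 * S + 2 + n →
                     (16 * suc m) * S ≤ 2 * (n * ((16 * suc m) * H + n * m)) + (16 * suc m) * (p * p) →
                     3 * (n * n) ≤ 16 * (n * H) + 8 * (p * p) + 8 + 4 * n
density-inequality m n H S p n²≤ NS≤ = *-cancelˡ-≤ N (m+n≤o⇒m≤o _ (+-cancelʳ-≤ (16 * (n * n * m)) _ _ chain))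
  where
  open ≤-Reasoning
  N = 16 * suc m
  chain : N * (3 * (n * n)) + 16 * (n * n) + 16 * (n * n * m)
          ≤ N * (16 * (n * H) + 8 * (p * p) + 8 + 4 * n) + 16 * (n * n * m)
  chain = begin
      N * (3 * (n * n)) + 16 * (n * n) + 16 * (n * n * m)     ≡⟨ lhs m n ⟩
      4 * (N * (n * n))                                        ≤⟨ *-monoʳ-≤ 4 (*-monoʳ-≤ N n²≤) ⟩
      4 * (N * (2 * S + 2 + n))                                ≡⟨ expand m S n ⟩
      4 * (2 * (N * S) + N * (2 + n))                          ≤⟨ *-monoʳ-≤ 4 (+-monoˡ-≤ (N * (2 + n)) (*-monoʳ-≤ 2 NS≤)) ⟩
      4 * (2 * (2 * (n * (N * H + n * m)) + N * (p * p)) + N * (2 + n))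
                                                               ≡⟨ rhs m n H p ⟩
      N * (16 * (n * H) + 8 * (p * p) + 8 + 4 * n) + 16 * (n * n * m) ∎
    where
    lhs : ∀ m n → (16 * suc m) * (3 * (n * n)) + 16 * (n * n) + 16 * (n * n * m) ≡ 4 * ((16 * suc m) * (n * n))
    lhs = solve-∀
    expand : ∀ m S n → 4 * ((16 * suc m) * (2 * S + 2 + n)) ≡ 4 * (2 * ((16 * suc m) * S) + (16 * suc m) * (2 + n))
    expand = solve-∀
    rhs : ∀ m n H p → 4 * (2 * (2 * (n * ((16 * suc m) * H + n * m)) + (16 * suc m) * (p * p)) + (16 * suc m) * (2 + n))
                      ≡ (16 * suc m) * (16 * (n * H) + 8 * (p * p) + 8 + 4 * n) + 16 * (n * n * m)
    rhs = solve-∀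

4*square≤square-of-sum : ∀ p q → p ≤ q → 4 * (p * p) ≤ (p + q) * (p + q)
4*square≤square-of-sum p q p≤q = begin
    4 * (p * p)                          ≡⟨ lhs p ⟩
    p * p + 2 * (p * p) + p * p          ≤⟨ +-mono-≤ (+-monoʳ-≤ (p * p) (*-monoʳ-≤ 2 (*-monoʳ-≤ p p≤q))) (*-mono-≤ p≤q p≤q) ⟩
    p * p + 2 * (p * q) + q * q          ≡⟨ rhs p q ⟩
    (p + q) * (p + q)                    ∎
  where
  open ≤-Reasoning
  lhs : ∀ p → 4 * (p * p) ≡ p * p + 2 * (p * p) + p * p
  lhs = solve-∀
  rhs : ∀ p q → p * p + 2 * (p * q) + q * q ≡ (p + q) * (p + q)
  rhs = solve-∀

bounded-by-density : ∀ n H p q μ M → p ≤ q → p + q ≤ n + μ → μ ≤ M →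
                     3 * (n * n) ≤ 16 * (n * H) + 8 * (p * p) + 8 + 4 * n →
                     n ≤ 16 * H + 4 * M + 2 * (M * M) + 12
bounded-by-density zero    H p q μ M _   _    _   _  = z≤n
bounded-by-density n@(suc _) H p q μ M p≤q p+q≤ μ≤M 3n²≤ = *-cancelˡ-≤ n (*-cancelˡ-≤ 2 (≤-trans 2n²≤ bound))
  where
  open ≤-Reasoning
  4p²≤ : 4 * (p * p) ≤ (n + M) * (n + M)
  4p²≤ = ≤-trans (4*square≤square-of-sum p q p≤q) (*-mono-≤ p+q≤n+M p+q≤n+M)
    where p+q≤n+M = ≤-trans p+q≤ (+-monoʳ-≤ n μ≤M)
  2n²≤ : 2 * (n * n) ≤ 32 * (n * H) + 8 * (n * M) + 4 * (M * M) + 16 + 8 * n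
  2n²≤ = +-cancelˡ-≤ (4 * (n * n)) _ _ (begin
      4 * (n * n) + 2 * (n * n)                                   ≡⟨ lhs n ⟩
      2 * (3 * (n * n))                                           ≤⟨ *-monoʳ-≤ 2 3n²≤ ⟩
      2 * (16 * (n * H) + 8 * (p * p) + 8 + 4 * n)                ≡⟨ mid n H p ⟩
      32 * (n * H) + 4 * (4 * (p * p)) + 16 + 8 * n               ≤⟨ +-monoˡ-≤ (8 * n) (+-monoˡ-≤ 16 (+-monoʳ-≤ (32 * (n * H)) (*-monoʳ-≤ 4 4p²≤))) ⟩
      32 * (n * H) + 4 * ((n + M) * (n + M)) + 16 + 8 * n         ≡⟨ rhs n H M ⟩
      4 * (n * n) + (32 * (n * H) + 8 * (n * M) + 4 * (M * M) + 16 + 8 * n) ∎)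
    where
    lhs : ∀ n → 4 * (n * n) + 2 * (n * n) ≡ 2 * (3 * (n * n))
    lhs = solve-∀
    mid : ∀ n H p → 2 * (16 * (n * H) + 8 * (p * p) + 8 + 4 * n) ≡ 32 * (n * H) + 4 * (4 * (p * p)) + 16 + 8 * n
    mid = solve-∀
    rhs : ∀ n H M → 32 * (n * H) + 4 * ((n + M) * (n + M)) + 16 + 8 * n
                    ≡ 4 * (n * n) + (32 * (n * H) + 8 * (n * M) + 4 * (M * M) + 16 + 8 * n)
    rhs = solve-∀
  bound : 32 * (n * H) + 8 * (n * M) + 4 * (M * M) + 16 + 8 * n ≤ 2 * (n * (16 * H + 4 * M + 2 * (M * M) + 12))
  bound = begin
      32 * (n * H) + 8 * (n * M) + 4 * (M * M) + 16 + 8 * n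
        ≤⟨ +-monoˡ-≤ (8 * n) (+-mono-≤ (+-monoʳ-≤ (32 * (n * H) + 8 * (n * M)) (*-monoʳ-≤ 4 (m≤m*n (M * M) n)))
                                        (*-monoʳ-≤ 16 (m≤n*m 1 n))) ⟩
      32 * (n * H) + 8 * (n * M) + 4 * (M * M * n) + 16 * (n * 1) + 8 * n  ≡⟨ rhs n H M ⟩
      2 * (n * (16 * H + 4 * M + 2 * (M * M) + 12))                 ∎
    where
    rhs : ∀ n H M → 32 * (n * H) + 8 * (n * M) + 4 * (M * M * n) + 16 * (n * 1) + 8 * n ≡ 2 * (n * (16 * H + 4 * M + 2 * (M * M) + 12))
    rhs = solve-∀

m+m≤1+n+o⇒m≤n⊎m≤o : ∀ m n o → m + m ≤ suc (n + o) → m ≤ n ⊎ m ≤ o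
m+m≤1+n+o⇒m≤n⊎m≤o m n o m+m≤ with m ≤? n
... | yes m≤n = inj₁ m≤n
... | no  m≰n = inj₂ (+-cancelˡ-≤ m m o (≤-trans m+m≤ (+-monoˡ-≤ o (≰⇒> m≰n))))

length-filter-partition : ∀ {A : Set} {P : Pred A 0ℓ} (P? : Decidable P) xs →
                          length (filter P? xs) + length (filter (¬? ∘ P?) xs) ≡ length xs
length-filter-partition P? []       = refl
length-filter-partition P? (x ∷ xs) with P? x
... | yes _ = cong suc (length-filter-partition P? xs)
... | no  _ = trans (+-suc _ _) (cong suc (length-filter-partition P? xs))

⊆-filter⇒All : ∀ {A : Set} {P : Pred A 0ℓ} (P? : Decidable P) xs {X} → X ⊆ filter P? xs → All P X
⊆-filter⇒All P? xs X⊆ = All-resp-⊆ X⊆ (all-filter P? xs)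

length-take-≤ : ∀ {A : Set} n (xs : List A) → n ≤ length xs → length (take n xs) ≡ n
length-take-≤ n xs n≤ = trans (length-take n xs) (m≤n⇒m⊓n≡m n≤)

AllPairs-resp-⊆ : ∀ {A : Set} {R : A → A → Set} {xs ys} → xs ⊆ ys → AllPairs R ys → AllPairs R xs
AllPairs-resp-⊆ []         []         = []
AllPairs-resp-⊆ (y ∷ʳ xs⊆) (_ ∷ rys)  = AllPairs-resp-⊆ xs⊆ rys
AllPairs-resp-⊆ (refl ∷ xs⊆) (ry ∷ rys) = All-resp-⊆ xs⊆ ry ∷ AllPairs-resp-⊆ xs⊆ rys

length-filter-tabulate : ∀ {A : Set} {k} (p : A → Bool) (f : Fin k → A) →
                         length (filter (T? ∘ p) (tabulate f)) ≡ countF (p ∘ f)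
length-filter-tabulate {k = zero}  p f = refl
length-filter-tabulate {k = suc k} p f with p (f zero)
... | true  = cong suc (length-filter-tabulate p (f ∘ suc))
... | false = length-filter-tabulate p (f ∘ suc)

index : ∀ {A : Set} {m} (xs : List A) → length xs ≡ m → Fin m → A
index xs ∣xs∣ i = lookup xs (cast (sym ∣xs∣) i)

All-index : ∀ {A : Set} {P : A → Set} {m} {xs : List A} (∣xs∣ : length xs ≡ m) → All P xs → ∀ i → P (index xs ∣xs∣ i)
All-index {xs = xs} ∣xs∣ pxs i = All.lookup pxs (∈-lookup (cast (sym ∣xs∣) i))

AllPairs-lookup : ∀ {A : Set} {R : A → A → Set} → Symmetric R → ∀ {xs} → AllPairs R xs →
                  ∀ {i j} → i ≢ j → R (lookup xs i) (lookup xs j)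
AllPairs-lookup sym-R (r ∷ rs) {zero}  {zero}  0≢0 = ⊥-elim (0≢0 refl)
AllPairs-lookup sym-R (r ∷ rs) {zero}  {suc j} _   = All.lookup r (∈-lookup j)
AllPairs-lookup sym-R (r ∷ rs) {suc i} {zero}  _   = sym-R (All.lookup r (∈-lookup i))
AllPairs-lookup sym-R (r ∷ rs) {suc i} {suc j} i≢j = AllPairs-lookup sym-R rs (i≢j ∘ cong suc)

AllPairs-index : ∀ {A : Set} {R : A → A → Set} {m} → Symmetric R → ∀ {xs} (∣xs∣ : length xs ≡ m) → AllPairs R xs →
                 ∀ {i j} → i ≢ j → R (index xs ∣xs∣ i) (index xs ∣xs∣ j)
AllPairs-index sym-R ∣xs∣ rs {i} {j} i≢j = AllPairs-lookup sym-R rs λ casts≡ →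
  i≢j (trans (sym (Fin.cast-involutive ∣xs∣ (sym ∣xs∣) i))
             (trans (cong (cast ∣xs∣) casts≡) (Fin.cast-involutive ∣xs∣ (sym ∣xs∣) j)))

*-sum-lower-bound : ∀ {A : Set} k c (f : A → ℕ) X → All (λ x → k < c * f x) X → length X * suc k ≤ c * sum (map f X)
*-sum-lower-bound k c f []      []       = z≤n
*-sum-lower-bound k c f (x ∷ X) (k< ∷ ks) =
  ≤-trans (+-mono-≤ k< (*-sum-lower-bound k c f X ks)) (≤-reflexive (sym (*-distribˡ-+ c (f x) (sum (map f X)))))

module _ {A : Set} (E : A → A → Bool) where

  private
    Red Blue : A → A → Set
    Red  u v = T (E u v)
    Blue u v = ¬ T (E u v)

  ramsey : ∀ a b (L : List A) → 2 ^ (a + b) ≤ length L →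
           (∃ λ X → X ⊆ L × length X ≡ a × AllPairs Red X) ⊎ (∃ λ X → X ⊆ L × length X ≡ b × AllPairs Blue X)
  ramsey zero    b       L       _ = inj₁ ([] , minimum L , refl , [])
  ramsey (suc a) zero    L       _ = inj₂ ([] , minimum L , refl , [])
  ramsey (suc a) (suc b) []      2^≤0 = ⊥-elim (<⇒≱ (m^n>0 2 (suc a + suc b)) 2^≤0)
  ramsey (suc a) (suc b) (v ∷ L) 2^≤ with m+m≤1+n+o⇒m≤n⊎m≤o (2 ^ (a + suc b)) (length Rs) (length Bs) double≤
    where
    Rs = filter (T? ∘ E v) L
    Bs = filter (¬? ∘ T? ∘ E v) L
    double≤ : 2 ^ (a + suc b) + 2 ^ (a + suc b) ≤ suc (length Rs + length Bs)
    double≤ = subst₂ _≤_ (cong (2 ^ (a + suc b) +_) (+-identityʳ _))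
                         (cong suc (sym (length-filter-partition (T? ∘ E v) L))) 2^≤
  ... | inj₁ big with ramsey a (suc b) (filter (T? ∘ E v) L) big
  ...   | inj₁ (X , X⊆ , ∣X∣ , red) =
          inj₁ (v ∷ X , refl ∷ ⊆-trans X⊆ (filter-⊆ (T? ∘ E v) L) , cong suc ∣X∣
               , ⊆-filter⇒All (T? ∘ E v) L X⊆ ∷ red)
  ...   | inj₂ (X , X⊆ , ∣X∣ , blue) = inj₂ (X , v ∷ʳ ⊆-trans X⊆ (filter-⊆ (T? ∘ E v) L) , ∣X∣ , blue)
  ramsey (suc a) (suc b) (v ∷ L) 2^≤ | inj₂ big
    with ramsey (suc a) b (filter (¬? ∘ T? ∘ E v) L) (subst (λ e → 2 ^ e ≤ length (filter (¬? ∘ T? ∘ E v) L)) (+-suc a b) big)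
  ... | inj₁ (X , X⊆ , ∣X∣ , red) = inj₁ (X , v ∷ʳ ⊆-trans X⊆ (filter-⊆ (¬? ∘ T? ∘ E v) L) , ∣X∣ , red)
  ... | inj₂ (X , X⊆ , ∣X∣ , blue) =
          inj₂ (v ∷ X , refl ∷ ⊆-trans X⊆ (filter-⊆ (¬? ∘ T? ∘ E v) L) , cong suc ∣X∣
               , ⊆-filter⇒All (¬? ∘ T? ∘ E v) L X⊆ ∷ blue)

-- Equal to m·C(x,k) + Σ_{i<k} C(x,i); the recursion mirrors the induction in biclique.
bicliqueBound : ℕ → ℕ → ℕ → ℕ
bicliqueBound m x       zero    = m
bicliqueBound m zero    (suc k) = 1
bicliqueBound m (suc x) (suc k) = bicliqueBound m x k + bicliqueBound m x (suc k)

module _ {A B : Set} (E : A → B → Bool) where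

  neighboursIn : A → List B → ℕ
  neighboursIn w X = length (filter (T? ∘ E w) X)

  private
    Adjacent : A → B → Set
    Adjacent w x = T (E w x)

    adjacentTo : B → A → Bool
    adjacentTo x w = E w x

  -- Split on whether enough of W is adjacent to the first vertex of X to put it into Y.
  biclique : ∀ m k (X : List B) (W : List A) → All (λ w → k ≤ neighboursIn w X) W →
             bicliqueBound m (length X) k ≤ length W →
             ∃₂ λ Y Z → Y ⊆ X × length Y ≡ k × Z ⊆ W × length Z ≡ m × All (λ w → All (Adjacent w) Y) Z
  biclique m zero X W _ m≤∣W∣ =
    [] , take m W , minimum X , refl , take-⊆ m W , length-take-≤ m W m≤∣W∣ , All.tabulate (λ _ → [])
  biclique m (suc k) [] (w ∷ W) (() ∷ _) _
  biclique m (suc k) (x ∷ X) W deg≤ bound≤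
    with bicliqueBound m (length X) k ≤? length (filter (T? ∘ adjacentTo x) W)
  ... | yes bound≤∣W⁺∣ with biclique m k X W⁺ deg⁺ bound≤∣W⁺∣
    where
    W⁺ = filter (T? ∘ adjacentTo x) W
    deg⁺ : All (λ w → k ≤ neighboursIn w X) W⁺
    deg⁺ = All.zipWith (λ (k<deg , w~x) → ≤-pred (subst (suc k ≤_) (cong length (filter-accept (T? ∘ E _) w~x)) k<deg))
                       (All-filter⁺ (T? ∘ adjacentTo x) deg≤ , all-filter (T? ∘ adjacentTo x) W)
  ... | Y , Z , Y⊆ , ∣Y∣ , Z⊆ , ∣Z∣ , complete =
          x ∷ Y , Z , refl ∷ Y⊆ , cong suc ∣Y∣ , ⊆-trans Z⊆ (filter-⊆ (T? ∘ adjacentTo x) W) , ∣Z∣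
        , All.zipWith (λ (w~x , w~Y) → w~x ∷ w~Y) (⊆-filter⇒All (T? ∘ adjacentTo x) W Z⊆ , complete)
  biclique m (suc k) (x ∷ X) W deg≤ bound≤ | no bound≰∣W⁺∣
    with biclique m (suc k) X W⁻ deg⁻ bound≤∣W⁻∣
    where
    W⁺ = filter (T? ∘ adjacentTo x) W
    W⁻ = filter (¬? ∘ T? ∘ adjacentTo x) W
    deg⁻ : All (λ w → suc k ≤ neighboursIn w X) W⁻
    deg⁻ = All.zipWith (λ (k<deg , w≁x) → subst (suc k ≤_) (cong length (filter-reject (T? ∘ E _) w≁x)) k<deg)
                       (All-filter⁺ (¬? ∘ T? ∘ adjacentTo x) deg≤ , all-filter (¬? ∘ T? ∘ adjacentTo x) W)
    bound≤∣W⁻∣ : bicliqueBound m (length X) (suc k) ≤ length W⁻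
    bound≤∣W⁻∣ = +-cancelˡ-≤ (length W⁺) _ _ (≤-trans (+-monoˡ-≤ _ (<⇒≤ (≰⇒> bound≰∣W⁺∣)))
                   (subst (_ ≤_) (sym (length-filter-partition (T? ∘ adjacentTo x) W)) bound≤))
  ... | Y , Z , Y⊆ , ∣Y∣ , Z⊆ , ∣Z∣ , complete =
          Y , Z , x ∷ʳ Y⊆ , ∣Y∣ , ⊆-trans Z⊆ (filter-⊆ (¬? ∘ T? ∘ adjacentTo x) W) , ∣Z∣ , complete

neighboursIn-∷ : ∀ {A B : Set} (E : A → B → Bool) w x X → neighboursIn E w (x ∷ X) ≡ ind (E w x) + neighboursIn E w X
neighboursIn-∷ E w x X with E w x
... | true  = refl
... | false = refl

opp : Colour → Colour
opp R = B
opp B = R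

is : Colour → Colour → Bool
is R = isR
is B = isB

T-is⇒≡ : ∀ c x → T (is c x) → x ≡ c
T-is⇒≡ R R _ = refl
T-is⇒≡ B B _ = refl

¬T-is⇒T-is-opp : ∀ c x → ¬ T (is c x) → T (is (opp c) x)
¬T-is⇒T-is-opp R R ¬R = ¬R _
¬T-is⇒T-is-opp R B _  = _
¬T-is⇒T-is-opp B R _  = _
¬T-is⇒T-is-opp B B ¬B = ¬B _

is-if : ∀ c b → is c (if b then opp c else c) ≡ not b
is-if R true  = refl
is-if R false = refl
is-if B true  = refl
is-if B false = refl

is-opp-if : ∀ c b → is (opp c) (if b then opp c else c) ≡ b
is-opp-if R true  = refl
is-opp-if R false = refl
is-opp-if B true  = refl
is-opp-if B false = refl

module _ {n : ℕ} (φ : Colouring n) where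

  edge : Colour → Fin n → Fin n → Bool
  edge c u v = not ⌊ u ≟ v ⌋ ∧ is c (col φ u v)

  Edge : Colour → Fin n → Fin n → Set
  Edge c u v = T (edge c u v)

  deg : Colour → Fin n → ℕ
  deg c v = countF (edge c v)

  edge-sym : ∀ c u v → edge c u v ≡ edge c v u
  edge-sym c u v with u ≟ v | v ≟ u
  ... | yes refl | yes _ = refl
  ... | yes u≡v  | no v≢u = ⊥-elim (v≢u (sym u≡v))
  ... | no u≢v   | yes v≡u = ⊥-elim (u≢v (sym v≡u))
  ... | no _     | no _ = cong (is c) (colSym φ u v)

  Edge-sym : ∀ c → Symmetric (Edge c)
  Edge-sym c {u} {v} = subst T (edge-sym c u v)

  Edge⇒≢ : ∀ c {u v} → Edge c u v → u ≢ v
  Edge⇒≢ c {u} {v} e u≡v with u ≟ v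
  ... | no u≢v = u≢v u≡v

  Edge⇒col : ∀ c {u v} → Edge c u v → col φ u v ≡ c
  Edge⇒col c {u} {v} e with u ≟ v
  ... | no _ = T-is⇒≡ c (col φ u v) e

  ¬Edge⇒Edge-opp : ∀ c {u v} → u ≢ v → ¬ Edge c u v → Edge (opp c) u v
  ¬Edge⇒Edge-opp c {u} {v} u≢v ¬e with u ≟ v
  ... | yes u≡v = ⊥-elim (u≢v u≡v)
  ... | no _    = ¬T-is⇒T-is-opp c (col φ u v) ¬e

  -- Edges inside the stable side are unconstrained, so only the independence of I matters for G.
  record SplitGraphCopy (m : ℕ) (c : Colour) : Set where
    field
      clique           : Fin m → Fin n
      stable           : Fin m → Fin n
      clique-edge      : ∀ {i j} → i ≢ j → Edge c (clique i) (clique j)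
      stable-injective : Injective _≡_ _≡_ stable
      cross-edge       : ∀ i j → Edge (opp c) (stable i) (clique j)

  splitGraphCopy : ∀ {m c} (Q S : List (Fin n)) (∣Q∣ : length Q ≡ m) (∣S∣ : length S ≡ m) →
                   AllPairs (Edge c) Q → AllPairs _≢_ S → All (λ w → All (Edge (opp c) w) Q) S →
                   SplitGraphCopy m c
  splitGraphCopy {c = c} Q S ∣Q∣ ∣S∣ Q-clique S-distinct cross = record
    { clique           = index Q ∣Q∣
    ; stable           = index S ∣S∣
    ; clique-edge      = AllPairs-index (Edge-sym c) ∣Q∣ Q-clique
    ; stable-injective = λ {i} {j} → stable-injective i j
    ; cross-edge       = λ i j → All-index ∣Q∣ (All-index ∣S∣ cross i) j
    }
    where
    stable-injective : ∀ i j → index S ∣S∣ i ≡ index S ∣S∣ j → i ≡ j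
    stable-injective i j eq with i ≟ j
    ... | yes i≡j = i≡j
    ... | no  i≢j = ⊥-elim (AllPairs-index (λ x≢y → x≢y ∘ sym) ∣S∣ S-distinct i≢j eq)

sumF-deg : ∀ {n} (φ : Colouring n) d → sumF (deg φ d) ≡ countPairs (λ i j → is d (col φ i j)) + countPairs (λ i j → is d (col φ i j))
sumF-deg φ d = trans (sumF-countF-≢ (λ i j → is d (col φ i j)))
                     (cong (countPairs (λ i j → is d (col φ i j)) +_) (countPairs-cong (λ i j → cong (is d) (colSym φ j i))))

sumF-neighboursIn : ∀ {n} (φ : Colouring n) c X → sumF (λ w → neighboursIn (edge φ c) w X) ≡ sum (map (deg φ c) X)
sumF-neighboursIn {n} φ c []      = trans (sumF-const n 0) (*-zeroʳ n)
sumF-neighboursIn {n} φ c (x ∷ X) = begin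
    sumF (λ w → neighboursIn (edge φ c) w (x ∷ X))                               ≡⟨ sumF-cong (λ w → neighboursIn-∷ (edge φ c) w x X) ⟩
    sumF (λ w → ind (edge φ c w x) + neighboursIn (edge φ c) w X)                ≡⟨ sumF-distrib-+ (λ w → ind (edge φ c w x)) _ ⟩
    countF (λ w → edge φ c w x) + sumF (λ w → neighboursIn (edge φ c) w X)       ≡⟨ cong₂ _+_ (sumF-cong (λ w → cong ind (edge-sym φ c w x)))
                                                                                             (sumF-neighboursIn φ c X) ⟩
    deg φ c x + sum (map (deg φ c) X)                                             ∎
  where open ≡-Reasoning

module Density {n : ℕ} (φ : Colouring n) (N K : ℕ) where

  small : Colour → Fin n → Bool
  small d v = N * deg φ d v ≤ᵇ K

  numLarge : Colour → ℕ
  numLarge d = countF (λ v → not (small d v))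

  private
    ind-split : ∀ b x → x ≡ ind b * x + ind (not b) * x
    ind-split true  x = sym (trans (+-identityʳ (x + 0)) (+-identityʳ x))
    ind-split false x = sym (+-identityʳ x)

    ind-≤ : ∀ b e → ind e ≤ ind b * ind e + ind (not b)
    ind-≤ true  e     = ≤-reflexive (sym (trans (+-identityʳ _) (+-identityʳ _)))
    ind-≤ false true  = s≤s z≤n
    ind-≤ false false = z≤n

    ind-*-+ : ∀ b x q → ind b * (x + q) ≤ x + ind b * q
    ind-*-+ true  x q = ≤-reflexive (trans (+-identityʳ (x + q)) (cong (x +_) (sym (+-identityʳ q))))
    ind-*-+ false x q = z≤n

  smallDegreeSum largeDegreeSum : Colour → ℕ
  smallDegreeSum d = sumF (λ v → ind (small d v) * deg φ d v)
  largeDegreeSum d = sumF (λ v → ind (not (small d v)) * deg φ d v)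

  degreeSum-split : ∀ d → sumF (deg φ d) ≡ smallDegreeSum d + largeDegreeSum d
  degreeSum-split d =
    trans (sumF-cong (λ v → ind-split (small d v) (deg φ d v)))
          (sumF-distrib-+ (λ v → ind (small d v) * deg φ d v) (λ v → ind (not (small d v)) * deg φ d v))

  N*smallDegreeSum≤ : ∀ d → N * smallDegreeSum d ≤ n * K
  N*smallDegreeSum≤ d = begin
      N * smallDegreeSum d                             ≡⟨ sumF-*ˡ N (λ v → ind (small d v) * deg φ d v) ⟨
      sumF (λ v → N * (ind (small d v) * deg φ d v))   ≤⟨ sumF-mono-≤ small≤ ⟩
      sumF {n} (λ _ → K)                               ≡⟨ sumF-const n K ⟩
      n * K                                            ∎
    where
    open ≤-Reasoning
    small≤ : ∀ v → N * (ind (small d v) * deg φ d v) ≤ K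
    small≤ v with small d v in eq
    ... | true  = ≤-trans (≤-reflexive (cong (N *_) (+-identityʳ (deg φ d v))))
                          (≤ᵇ⇒≤ (N * deg φ d v) K (subst T (sym eq) _))
    ... | false = ≤-trans (≤-reflexive (*-zeroʳ N)) z≤n

  -- A large vertex has at most numLarge d large neighbours, and the edges from large to small
  -- vertices are counted again in smallDegreeSum.
  largeDegreeSum≤ : ∀ d → largeDegreeSum d ≤ smallDegreeSum d + numLarge d * numLarge d
  largeDegreeSum≤ d = begin
      largeDegreeSum d                                              ≤⟨ sumF-mono-≤ large≤ ⟩
      sumF (λ v → smallNeighbours v + ind (not (s v)) * p)        ≡⟨ sumF-distrib-+ smallNeighbours (λ v → ind (not (s v)) * p) ⟩
      sumF smallNeighbours + sumF (λ v → ind (not (s v)) * p)     ≡⟨ cong₂ _+_ smallNeighbours-sum (sumF-*ʳ (λ v → ind (not (s v))) p) ⟩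
      smallDegreeSum d + p * p                                      ∎
    where
    open ≤-Reasoning
    s = small d
    p = numLarge d
    smallNeighbours : Fin n → ℕ
    smallNeighbours v = sumF (λ w → ind (s w) * ind (edge φ d v w))
    large≤ : ∀ v → ind (not (s v)) * deg φ d v ≤ smallNeighbours v + ind (not (s v)) * p
    large≤ v = ≤-trans (*-monoʳ-≤ (ind (not (s v))) deg≤) (ind-*-+ (not (s v)) (smallNeighbours v) p)
      where
      deg≤ : deg φ d v ≤ smallNeighbours v + p
      deg≤ = ≤-trans (sumF-mono-≤ (λ w → ind-≤ (s w) (edge φ d v w)))
                     (≤-reflexive (sumF-distrib-+ (λ w → ind (s w) * ind (edge φ d v w)) (λ w → ind (not (s w)))))
    smallNeighbours-sum : sumF smallNeighbours ≡ smallDegreeSum d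
    smallNeighbours-sum =
      trans (sumF-comm (λ v w → ind (s w) * ind (edge φ d v w)))
            (sumF-cong (λ w → trans (sumF-cong (λ v → cong (λ b → ind (s w) * ind b) (edge-sym φ d v w)))
                                    (sumF-*ˡ (ind (s w)) (λ v → ind (edge φ d w v)))))

  degree-sum-bound : ∀ d → N * sumF (deg φ d) ≤ 2 * (n * K) + N * (numLarge d * numLarge d)
  degree-sum-bound d = begin
      N * sumF (deg φ d)                 ≡⟨ cong (N *_) (degreeSum-split d) ⟩
      N * (Sₛ + Sₗ)                      ≤⟨ *-monoʳ-≤ N (+-monoʳ-≤ Sₛ (largeDegreeSum≤ d)) ⟩
      N * (Sₛ + (Sₛ + p * p))            ≡⟨ distrib N Sₛ (p * p) ⟩
      N * Sₛ + N * Sₛ + N * (p * p)      ≤⟨ +-monoˡ-≤ (N * (p * p)) (+-mono-≤ (N*smallDegreeSum≤ d) (N*smallDegreeSum≤ d)) ⟩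
      n * K + n * K + N * (p * p)        ≡⟨ cong (_+ N * (p * p)) (cong (n * K +_) (sym (+-identityʳ (n * K)))) ⟩
      2 * (n * K) + N * (p * p)          ∎
    where
    open ≤-Reasoning
    Sₛ = smallDegreeSum d
    Sₗ = largeDegreeSum d
    p  = numLarge d
    distrib : ∀ N a b → N * (a + (a + b)) ≡ N * a + N * a + N * b
    distrib = solve-∀

-- Chosen so that the n²·m term contributed by K in density-inequality is at most a quarter of N·n².
cliqueSize : ℕ → ℕ
cliqueSize m = 16 * suc m

-- One more than the bound of bounded-by-density, for H = bicliqueBound m N m and M = 2 ^ (N + N).
threshold : ℕ → ℕ
threshold m = suc (16 * bicliqueBound m N m + 4 * M + 2 * (M * M) + 12)
  where
  N = cliqueSize m
  M = 2 ^ (N + N)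

module SplitGraphCopies {n : ℕ} (φ : Colouring n) (m : ℕ) where

  N H K : ℕ
  N = cliqueSize m
  H = bicliqueBound m N m
  K = N * H + n * m

  open Density φ N K

  mixed : Fin n → Bool
  mixed v = not (small R v) ∧ not (small B v)

  ¬small⇒large : ∀ d v → ¬ T (small d v) → K < N * deg φ d v
  ¬small⇒large d v ¬small = ≰⇒> (¬small ∘ ≤⇒≤ᵇ)

  mixed⇒large : ∀ c v → T (mixed v) → K < N * deg φ c v
  mixed⇒large c v mixed-v with small R v in sR | small B v in sB
  mixed⇒large R v _  | false | _     = ¬small⇒large R v (subst T sR)
  mixed⇒large B v _  | false | false = ¬small⇒large B v (subst T sB)
  mixed⇒large B v () | false | true
  mixed⇒large c v () | true  | _

  hasManyNeighbours : Colour → List (Fin n) → Fin n → Bool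
  hasManyNeighbours d X w = m ≤ᵇ neighboursIn (edge φ d) w X

  splitGraphCopy-fromManyNeighbours : ∀ c X → length X ≡ N → AllPairs (Edge φ c) X →
                                      H ≤ countF (hasManyNeighbours (opp c) X) → SplitGraphCopy φ m c
  splitGraphCopy-fromManyNeighbours c X ∣X∣ X-clique H≤
    with biclique (edge φ (opp c)) m m X W (mapAll (≤ᵇ⇒≤ m _) (all-filter (T? ∘ many) (allFin n)))
                  (subst₂ (λ x w → bicliqueBound m x m ≤ w) (sym ∣X∣) (sym (length-filter-tabulate many (λ w → w))) H≤)
    where
    many = hasManyNeighbours (opp c) X
    W    = filter (T? ∘ many) (allFin n)
  ... | Y , Z , Y⊆X , ∣Y∣ , Z⊆W , ∣Z∣ , complete =
        splitGraphCopy φ Y Z ∣Y∣ ∣Z∣ (AllPairs-resp-⊆ Y⊆X X-clique)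
                       (AllPairs-resp-⊆ (⊆-trans Z⊆W (filter-⊆ (T? ∘ hasManyNeighbours (opp c) X) (allFin n))) (allFin⁺ n))
                       complete

  degreeSum≤ : ∀ d X → length X ≡ N → countF (hasManyNeighbours d X) < H → sum (map (deg φ d) X) ≤ K
  degreeSum≤ d X ∣X∣ few = begin
      sum (map (deg φ d) X)                                   ≡⟨ sumF-neighboursIn φ d X ⟨
      sumF (λ w → neighboursIn (edge φ d) w X)                ≤⟨ sumF-mono-≤ neighbours≤ ⟩
      sumF (λ w → ind (many w) * length X + m)                ≡⟨ sumF-distrib-+ (λ w → ind (many w) * length X) (λ _ → m) ⟩
      sumF (λ w → ind (many w) * length X) + sumF {n} (λ _ → m)
                                                              ≡⟨ cong₂ _+_ (sumF-*ʳ (λ w → ind (many w)) (length X)) (sumF-const n m) ⟩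
      countF many * length X + n * m                          ≤⟨ +-monoˡ-≤ (n * m) (*-mono-≤ (<⇒≤ few) (≤-reflexive ∣X∣)) ⟩
      H * N + n * m                                           ≡⟨ cong (_+ n * m) (*-comm H N) ⟩
      K                                                       ∎
    where
    open ≤-Reasoning
    many = hasManyNeighbours d X
    neighbours≤ : ∀ w → neighboursIn (edge φ d) w X ≤ ind (many w) * length X + m
    neighbours≤ w with many w in eq
    ... | true  = ≤-trans (length-filter (T? ∘ edge φ d w) X)
                          (≤-trans (m≤m+n (length X) m) (≤-reflexive (cong (_+ m) (sym (+-identityʳ (length X))))))
    ... | false = <⇒≤ (≰⇒> (λ m≤ → subst T eq (≤⇒≤ᵇ m≤)))

  -- Every vertex of a mixed clique has large degree in the opposite colour, so its degree sum exceeds K.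
  splitGraphCopy-onMixedClique : ∀ c X → length X ≡ N → AllPairs (Edge φ c) X → All (T ∘ mixed) X → SplitGraphCopy φ m c
  splitGraphCopy-onMixedClique c X ∣X∣ X-clique X-mixed with H ≤? countF (hasManyNeighbours (opp c) X)
  ... | yes H≤ = splitGraphCopy-fromManyNeighbours c X ∣X∣ X-clique H≤
  ... | no  H≰ = ⊥-elim (<-irrefl refl (*-cancelˡ-≤ N (begin
      N * suc K                            ≡⟨ cong (_* suc K) (sym ∣X∣) ⟩
      length X * suc K                     ≤⟨ *-sum-lower-bound K N (deg φ (opp c)) X (mapAll (mixed⇒large (opp c) _) X-mixed) ⟩
      N * sum (map (deg φ (opp c)) X)      ≤⟨ *-monoʳ-≤ N (degreeSum≤ (opp c) X ∣X∣ (≰⇒> H≰)) ⟩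
      N * K                                ∎)))
    where open ≤-Reasoning

  splitGraphCopy-fromMixed : 2 ^ (N + N) ≤ countF mixed → SplitGraphCopy φ m R ⊎ SplitGraphCopy φ m B
  splitGraphCopy-fromMixed many-mixed
    with ramsey (edge φ R) N N Mixed (subst (2 ^ (N + N) ≤_) (sym (length-filter-tabulate mixed (λ v → v))) many-mixed)
    where Mixed = filter (T? ∘ mixed) (allFin n)
  ... | inj₁ (X , X⊆ , ∣X∣ , red)  = inj₁ (splitGraphCopy-onMixedClique R X ∣X∣ red (⊆-filter⇒All (T? ∘ mixed) (allFin n) X⊆))
  ... | inj₂ (X , X⊆ , ∣X∣ , blue) = inj₂ (splitGraphCopy-onMixedClique B X ∣X∣ blue′ (⊆-filter⇒All (T? ∘ mixed) (allFin n) X⊆))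
    where
    blue′ : AllPairs (Edge φ B) X
    blue′ = AllPairs.zipWith (λ (u≢v , ¬red) → ¬Edge⇒Edge-opp φ R u≢v ¬red)
              (AllPairs-resp-⊆ (⊆-trans X⊆ (filter-⊆ (T? ∘ mixed) (allFin n))) (allFin⁺ n) , blue)

  square≤degreeSum : ∀ d → halfPairs n ≤ countPairs (λ i j → is d (col φ i j)) → n * n ≤ 2 * sumF (deg φ d) + 2 + n
  square≤degreeSum d half≤ = begin
      n * n                                     ≤⟨ square≤4*halfPairs n ⟩
      4 * halfPairs n + 2 + n                   ≡⟨ cong (λ t → t + 2 + n) (lemma (halfPairs n)) ⟩
      2 * (halfPairs n + halfPairs n) + 2 + n   ≤⟨ +-monoˡ-≤ n (+-monoˡ-≤ 2 (*-monoʳ-≤ 2 (+-mono-≤ half≤ half≤))) ⟩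
      2 * (e + e) + 2 + n                       ≡⟨ cong (λ t → 2 * t + 2 + n) (sumF-deg φ d) ⟨
      2 * sumF (deg φ d) + 2 + n                ∎
    where
    open ≤-Reasoning
    e = countPairs (λ i j → is d (col φ i j))
    lemma : ∀ h → 4 * h ≡ 2 * (h + h)
    lemma = solve-∀

  numLarge+numLarge≤ : numLarge R + numLarge B ≤ n + countF mixed
  numLarge+numLarge≤ = begin
      numLarge R + numLarge B                             ≡⟨ sumF-distrib-+ (λ v → ind (not (small R v))) (λ v → ind (not (small B v))) ⟨
      sumF (λ v → ind (not (small R v)) + ind (not (small B v)))
                                                          ≤⟨ sumF-mono-≤ (λ v → pointwise (small R v) (small B v)) ⟩
      sumF (λ v → 1 + ind (mixed v))                      ≡⟨ sumF-distrib-+ (λ _ → 1) (λ v → ind (mixed v)) ⟩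
      sumF {n} (λ _ → 1) + countF mixed                   ≡⟨ cong (_+ countF mixed) (trans (sumF-const n 1) (*-identityʳ n)) ⟩
      n + countF mixed                                    ∎
    where
    open ≤-Reasoning
    pointwise : ∀ x y → ind (not x) + ind (not y) ≤ 1 + ind (not x ∧ not y)
    pointwise true  true  = z≤n
    pointwise true  false = s≤s z≤n
    pointwise false true  = s≤s z≤n
    pointwise false false = s≤s (s≤s z≤n)

  splitGraphCopy-exists : threshold m ≤ n → halfPairs n ≤ numRed φ → halfPairs n ≤ numBlue φ →
                          SplitGraphCopy φ m R ⊎ SplitGraphCopy φ m B
  splitGraphCopy-exists n₀≤n half≤red half≤blue with 2 ^ (N + N) ≤? countF mixed
  ... | yes many-mixed = splitGraphCopy-fromMixed many-mixed
  ... | no  few-mixed  = ⊥-elim (<⇒≱ n₀≤n (bounded (≤-total (numLarge R) (numLarge B))))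
    where
    M = 2 ^ (N + N)
    density : ∀ d → halfPairs n ≤ countPairs (λ i j → is d (col φ i j)) →
              3 * (n * n) ≤ 16 * (n * H) + 8 * (numLarge d * numLarge d) + 8 + 4 * n
    density d half≤ = density-inequality m n H (sumF (deg φ d)) (numLarge d) (square≤degreeSum d half≤) (degree-sum-bound d)
    μ≤M : countF mixed ≤ M
    μ≤M = <⇒≤ (≰⇒> few-mixed)
    bounded : numLarge R ≤ numLarge B ⊎ numLarge B ≤ numLarge R → n ≤ 16 * H + 4 * M + 2 * (M * M) + 12
    bounded (inj₁ R≤B) = bounded-by-density n H _ _ (countF mixed) M R≤B numLarge+numLarge≤ μ≤M (density R half≤red)
    bounded (inj₂ B≤R) = bounded-by-density n H _ _ (countF mixed) M B≤R
                           (subst (_≤ n + countF mixed) (+-comm (numLarge R) (numLarge B)) numLarge+numLarge≤)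
                           μ≤M (density B half≤blue)

module _ {m : ℕ} (G : Graph m) (I : Fin m → Bool) where

  edgesOutside edgesTouching : ℕ
  edgesOutside  = countPairs (λ i j → adj G i j ∧ not (I i ∨ I j))
  edgesTouching = countPairs (λ i j → adj G i j ∧ (I i ∨ I j))

  numEdges-split : edgesOutside + edgesTouching ≡ numEdges G
  numEdges-split = countPairs-+ _ _ (adj G) (λ i j → pointwise (adj G i j) (I i ∨ I j))
    where
    pointwise : ∀ a b → ind (a ∧ not b) + ind (a ∧ b) ≡ ind a
    pointwise true  true  = refl
    pointwise true  false = refl
    pointwise false b     = refl

  -- Each edge touching an independent set has exactly one end in it.
  degSum≡edgesTouching : Independent G I → degSum G I ≡ edgesTouching
  degSum≡edgesTouching independent = begin
      degSum G I                                                                   ≡⟨ sumF-cong restrict ⟩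
      sumF (λ x → countF (λ y → not ⌊ x ≟ y ⌋ ∧ (I x ∧ adj G x y)))                ≡⟨ sumF-countF-≢ (λ x y → I x ∧ adj G x y) ⟩
      countPairs (λ x y → I x ∧ adj G x y) + countPairs (λ x y → I y ∧ adj G y x)  ≡⟨ countPairs-+ _ _ _ one-end ⟩
      edgesTouching                                                                ∎
    where
    open ≡-Reasoning
    restrict : ∀ x → (if I x then degree G x else 0) ≡ countF (λ y → not ⌊ x ≟ y ⌋ ∧ (I x ∧ adj G x y))
    restrict x with I x
    ... | false = sym (trans (sumF-cong (λ y → cong ind (∧-zeroʳ (not ⌊ x ≟ y ⌋)))) (trans (sumF-const m 0) (*-zeroʳ m)))
    ... | true  = sumF-cong (λ y → cong ind (loopless y))
      where
      loopless : ∀ y → adj G x y ≡ not ⌊ x ≟ y ⌋ ∧ adj G x y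
      loopless y with x ≟ y
      ... | yes refl = irrefl G x
      ... | no  _    = refl
    one-end : ∀ i j → ind (I i ∧ adj G i j) + ind (I j ∧ adj G j i) ≡ ind (adj G i j ∧ (I i ∨ I j))
    one-end i j rewrite Graph.sym G j i with I i in ei | I j in ej | adj G i j in ea
    ... | true  | true  | true  = case trans (sym ea) (independent i j ei ej) of λ ()
    ... | true  | true  | false = refl
    ... | true  | false | true  = refl
    ... | true  | false | false = refl
    ... | false | true  | true  = refl
    ... | false | true  | false = refl
    ... | false | false | true  = refl
    ... | false | false | false = refl

module _ {n m : ℕ} {φ : Colouring n} {c : Colour} (copy : SplitGraphCopy φ m c)
         (G : Graph m) (I : Fin m → Bool) (independent : Independent G I) where

  open SplitGraphCopy copy

  embed : Fin m → Fin n
  embed x = if I x then stable x else clique x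

  embed-injective : Injective _≡_ _≡_ embed
  embed-injective {x} {y} eq with x ≟ y
  ... | yes x≡y = x≡y
  ... | no  x≢y with I x | I y
  ...   | true  | true  = stable-injective eq
  ...   | false | false = ⊥-elim (Edge⇒≢ φ c (clique-edge x≢y) eq)
  ...   | true  | false = ⊥-elim (Edge⇒≢ φ (opp c) (cross-edge x y) eq)
  ...   | false | true  = ⊥-elim (Edge⇒≢ φ (opp c) (cross-edge y x) (sym eq))

  embed-colour : ∀ i j → adj G i j ≡ true → col φ (embed i) (embed j) ≡ (if I i ∨ I j then opp c else c)
  embed-colour i j ij∈G with i ≟ j
  ... | yes refl = case trans (sym ij∈G) (irrefl G i) of λ ()
  ... | no  i≢j with I i in ei | I j in ej
  ...   | true  | true  = case trans (sym ij∈G) (independent i j ei ej) of λ ()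
  ...   | false | false = Edge⇒col φ c (clique-edge i≢j)
  ...   | true  | false = Edge⇒col φ (opp c) (cross-edge i j)
  ...   | false | true  = trans (colSym φ (clique i) (stable j)) (Edge⇒col φ (opp c) (cross-edge j i))

  count-embedded : ∀ d → countPairs (λ i j → adj G i j ∧ is d (col φ (embed i) (embed j)))
                       ≡ countPairs (λ i j → adj G i j ∧ is d (if I i ∨ I j then opp c else c))
  count-embedded d = countPairs-cong pointwise
    where
    pointwise : ∀ i j → (adj G i j ∧ is d (col φ (embed i) (embed j))) ≡ (adj G i j ∧ is d (if I i ∨ I j then opp c else c))
    pointwise i j with adj G i j in ij∈G
    ... | true  = cong (is d) (embed-colour i j ij∈G)
    ... | false = refl

  embed-balanced : numEdges G / 2 ≤ degSum G I → degSum G I ≤ (numEdges G + 1) / 2 → BalancedCopy G φ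
  embed-balanced lower upper = embed , embed-injective , orient c outside≡ touching≡ balanced
    where
    colourCount : Colour → ℕ
    colourCount d = countPairs (λ i j → adj G i j ∧ is d (col φ (embed i) (embed j)))

    outside≡ : colourCount c ≡ edgesOutside G I
    outside≡ = trans (count-embedded c) (countPairs-cong (λ i j → cong (adj G i j ∧_) (is-if c (I i ∨ I j))))

    touching≡ : colourCount (opp c) ≡ edgesTouching G I
    touching≡ = trans (count-embedded (opp c)) (countPairs-cong (λ i j → cong (adj G i j ∧_) (is-opp-if c (I i ∨ I j))))

    balanced : edgesOutside G I ≤ suc (edgesTouching G I) × edgesTouching G I ≤ suc (edgesOutside G I)
    balanced = near-half⇒balanced (edgesOutside G I) (edgesTouching G I)
      (subst₂ (λ e t → e / 2 ≤ t) (sym (numEdges-split G I)) (degSum≡edgesTouching G I independent) lower)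
      (subst₂ (λ t e → t ≤ (e + 1) / 2) (degSum≡edgesTouching G I independent) (sym (numEdges-split G I)) upper)

    orient : ∀ c′ {o t} → colourCount c′ ≡ o → colourCount (opp c′) ≡ t → o ≤ suc t × t ≤ suc o →
             colourCount R ≤ suc (colourCount B) × colourCount B ≤ suc (colourCount R)
    orient R refl refl o,t = o,t
    orient B refl refl (o≤ , t≤) = t≤ , o≤

Exhaustible : Set → Set₁
Exhaustible A = ∀ {P : A → Set} → Decidable P → Dec (∃ P)

∀?-fromExhaustible : ∀ {A : Set} → Exhaustible A → ∀ {P : A → Set} → Decidable P → Dec (∀ x → P x)
∀?-fromExhaustible ∃? P? with ∃? (¬? ∘ P?)
... | yes (x , ¬Px) = no (λ ∀P → ¬Px (∀P x))
... | no  ¬∃¬P      = yes (λ x → decidable-stable (P? x) (λ ¬Px → ¬∃¬P (x , ¬Px)))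

exhaustible-Fin : ∀ k → Exhaustible (Fin k)
exhaustible-Fin k = Fin.any?

exhaustible-Colour : Exhaustible Colour
exhaustible-Colour P? with P? R | P? B
... | yes PR | _     = yes (R , PR)
... | no _   | yes PB = yes (B , PB)
... | no ¬PR | no ¬PB = no λ { (R , PR) → ¬PR PR ; (B , PB) → ¬PB PB }

exhaustible-Vec : ∀ {A : Set} → Exhaustible A → ∀ k → Exhaustible (Vec A k)
exhaustible-Vec ∃? zero    P? = map′ ([] ,_) (λ { ([] , P[]) → P[] }) (P? [])
exhaustible-Vec ∃? (suc k) P? =
  map′ (λ (a , v , P[a∷v]) → a ∷ v , P[a∷v]) (λ { (a ∷ v , P[a∷v]) → a , v , P[a∷v] })
       (∃? (λ a → exhaustible-Vec ∃? k (λ v → P? (a ∷ v))))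

module _ {m n : ℕ} (G : Graph m) where

  BalancedMap : Colouring n → (Fin m → Fin n) → Set
  BalancedMap φ f = Injective _≡_ _≡_ f × (redEdges ≤ suc blueEdges) × (blueEdges ≤ suc redEdges)
    where
    redEdges blueEdges : ℕ
    redEdges  = countPairs (λ i j → adj G i j ∧ isR (col φ (f i) (f j)))
    blueEdges = countPairs (λ i j → adj G i j ∧ isB (col φ (f i) (f j)))

  balancedMap? : ∀ φ f → Dec (BalancedMap φ f)
  balancedMap? φ f = (map′ (λ inj {x} {y} → inj x y) (λ inj x y → inj {x} {y})
                        (Fin.all? λ x → Fin.all? λ y → (f x ≟ f y) →-dec (x ≟ y)))
                     ×-dec (_ ≤? _) ×-dec (_ ≤? _)

  balancedMap-transfer : ∀ {φ ψ f g} → (∀ i → f i ≡ g i) → (∀ u v → col φ u v ≡ col ψ u v) →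
                         BalancedMap φ f → BalancedMap ψ g
  balancedMap-transfer {φ} {ψ} {f} {g} f≗g φ≗ψ (inj , red≤ , blue≤) =
    (λ {x} {y} gx≡gy → inj (trans (f≗g x) (trans gx≡gy (sym (f≗g y))))) ,
    subst₂ (λ r b → r ≤ suc b) (same isR) (same isB) red≤ ,
    subst₂ (λ b r → b ≤ suc r) (same isB) (same isR) blue≤
    where
    same : ∀ is? → countPairs (λ i j → adj G i j ∧ is? (col φ (f i) (f j))) ≡ countPairs (λ i j → adj G i j ∧ is? (col ψ (g i) (g j)))
    same is? = countPairs-cong λ i j → cong (λ x → adj G i j ∧ is? x)
                 (trans (φ≗ψ (f i) (f j)) (cong₂ (col ψ) (f≗g i) (f≗g j)))

  balancedCopy? : ∀ φ → Dec (BalancedCopy G φ)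
  balancedCopy? φ =
    map′ (λ (v , bal) → lookupᵥ v , bal)
         (λ (f , bal) → tabulateᵥ f , balancedMap-transfer {φ} {φ} (λ i → sym (lookup∘tabulate f i)) (λ _ _ → refl) bal)
         (exhaustible-Vec (exhaustible-Fin n) m (balancedMap? φ ∘ lookupᵥ))

-- Only the entries on or above the diagonal of the table are read.
fromTable : ∀ {n} → Vec (Vec Colour n) n → Colouring n
fromTable {n} t = record { col = colour ; colSym = colour-sym }
  where
  colour : Fin n → Fin n → Colour
  colour i j = if ⌊ i Fin.≤? j ⌋ then lookupᵥ (lookupᵥ t i) j else lookupᵥ (lookupᵥ t j) i
  colour-sym : ∀ i j → colour i j ≡ colour j i
  colour-sym i j with i Fin.≤? j | j Fin.≤? i
  ... | yes i≤j | yes j≤i rewrite Fin.≤-antisym i≤j j≤i = refl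
  ... | yes _   | no _    = refl
  ... | no _    | yes _   = refl
  ... | no i≰j  | no j≰i  = ⊥-elim (i≰j (≰⇒≥ j≰i))

toTable : ∀ {n} → Colouring n → Vec (Vec Colour n) n
toTable φ = tabulateᵥ (λ i → tabulateᵥ (col φ i))

fromTable-toTable : ∀ {n} (φ : Colouring n) u v → col (fromTable (toTable φ)) u v ≡ col φ u v
fromTable-toTable φ u v with u Fin.≤? v
... | yes _ = trans (cong (λ row → lookupᵥ row v) (lookup∘tabulate _ u)) (lookup∘tabulate _ v)
... | no  _ = trans (cong (λ row → lookupᵥ row u) (lookup∘tabulate _ v)) (trans (lookup∘tabulate _ u) (colSym φ v u))

balProp? : ∀ {m} (G : Graph m) n k → Dec (BalProp G n k)
balProp? G n k = map′ (λ bal φ → transfer φ (bal (toTable φ))) (λ bal t → bal (fromTable t))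
  (∀?-fromExhaustible (exhaustible-Vec (exhaustible-Vec exhaustible-Colour n) n)
     (λ t → (suc k ≤? numRed (fromTable t)) →-dec (suc k ≤? numBlue (fromTable t)) →-dec balancedCopy? G (fromTable t)))
  where
  transfer : ∀ φ → (k < numRed (fromTable (toTable φ)) → k < numBlue (fromTable (toTable φ)) → BalancedCopy G (fromTable (toTable φ))) →
             k < numRed φ → k < numBlue φ → BalancedCopy G φ
  transfer φ bal k<red k<blue =
    let (f , balanced) = bal (subst (k <_) (same isR) k<red) (subst (k <_) (same isB) k<blue)
    in f , balancedMap-transfer G {fromTable (toTable φ)} {φ} {f} (λ _ → refl) (fromTable-toTable φ) balanced
    where
    same : ∀ is? → countPairs (λ i j → is? (col φ i j)) ≡ countPairs (λ i j → is? (col (fromTable (toTable φ)) i j))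
    same is? = countPairs-cong λ i j → cong is? (sym (fromTable-toTable φ i j))

module _ {P : ℕ → Set} (P? : Decidable P) where

  private
    Least : ℕ → Set
    Least j = P j × (∀ i → i < j → ¬ P i)

    least-below : ∀ k → (∃ λ j → j < k × Least j) ⊎ (∀ i → i < k → ¬ P i)
    least-below zero    = inj₂ (λ _ ())
    least-below (suc k) with least-below k
    ... | inj₁ (j , j<k , least) = inj₁ (j , m<n⇒m<1+n j<k , least)
    ... | inj₂ none with P? k
    ...   | yes Pk = inj₁ (k , ≤-refl , Pk , none)
    ...   | no ¬Pk = inj₂ λ i i<1+k → case m≤n⇒m<n∨m≡n (≤-pred i<1+k) of λ where
                        (inj₁ i<k)  → none i i<k
                        (inj₂ refl) → ¬Pk

  least : ∀ k → P k → ∃ λ j → j ≤ k × P j × (∀ i → i < j → ¬ P i)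
  least k Pk with least-below (suc k)
  ... | inj₁ (j , j<1+k , least) = j , ≤-pred j<1+k , least
  ... | inj₂ none = ⊥-elim (none k ≤-refl Pk)

0<halfPairs : ∀ n → 3 ≤ n → 0 < halfPairs n
0<halfPairs n 3≤n = ≰⇒> λ half≤0 → <⇒≱ (n+2<n*n) (begin
    n * n                    ≤⟨ square≤4*halfPairs n ⟩
    4 * halfPairs n + 2 + n  ≤⟨ +-monoˡ-≤ n (+-monoˡ-≤ 2 (*-monoʳ-≤ 4 half≤0)) ⟩
    2 + n                    ∎)
  where
  open ≤-Reasoning
  n+2<n*n : 2 + n < n * n
  n+2<n*n = begin
    3 + n              ≤⟨ +-monoˡ-≤ n 3≤n ⟩
    n + n              ≤⟨ +-monoʳ-≤ n (m≤m+n n (n + 0)) ⟩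
    3 * n              ≤⟨ *-monoˡ-≤ n 3≤n ⟩
    n * n              ∎

3≤threshold : ∀ m → 3 ≤ threshold m
3≤threshold m = s≤s (≤-trans (s≤s (s≤s z≤n)) (m≤n+m 12 _))

balancedCopy-whenBothHalf : ∀ {m n} (G : Graph m) → SimplyBalanceable G → threshold m ≤ n →
                            ∀ φ → halfPairs n ≤ numRed φ → halfPairs n ≤ numBlue φ → BalancedCopy G φ
balancedCopy-whenBothHalf {m} G (I , independent , lower , upper) n₀≤n φ half≤red half≤blue
  with SplitGraphCopies.splitGraphCopy-exists φ m n₀≤n half≤red half≤blue
... | inj₁ copy = embed-balanced copy G I independent lower upper
... | inj₂ copy = embed-balanced copy G I independent lower upper

balExists : ∀ {m} (G : Graph m) n k → k < halfPairs n → BalProp G n k → BalExists G n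
balExists G n k k<half bal =
  let j , j≤k , balProp-j , minimal = least (balProp? G n) k bal
  in  j , ≤-<-trans j≤k k<half , balProp-j , minimal

proposition2p3 : (m : ℕ) (G : Graph m) → SimplyBalanceable G → Balanceable G
proposition2p3 m G simply = threshold m , balancedFrom
  where
  balancedFrom : ∀ n → threshold m ≤ n → BalExists G n
  balancedFrom n n₀≤n = balExists G n (pred half) (≤-reflexive (suc-pred half)) λ φ above-red above-blue →
    balancedCopy-whenBothHalf G simply n₀≤n φ (subst (_≤ numRed φ) (suc-pred half) above-red)
                                               (subst (_≤ numBlue φ) (suc-pred half) above-blue)
    where
    half = halfPairs n
    instance
      half-nonZero : NonZero half
      half-nonZero = >-nonZero (0<halfPairs n (≤-trans (3≤threshold m) n₀≤n))
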